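{- Let $m$ and $n$ be non-negative integers. Then \[ \sum_{k=1}^n k^mF_k = P_1 (m,n)F_n + P_2 (m,n)F_{n + 1} + C(m),\qquad \sum_{k=1}^n k^mL_k = P_1 (m,n)L_n + P_2 (m,n)L_{n + 1} + K(m), \] where $P_1(m,n)$, $P_2(m,n)$, $C(m)$ and $K(m)$ are defined recursively (for all non-negative integers $m$) by \[ P_1 (m,n) = (n + 2)^m - \sum_{j = 0}^{m - 1} \binom mj(2^{m - j} + 1)P_1 (j,n),\qquad P_2 (m,n) = (n + 1)^m - \sum_{j = 0}^{m - 1} \binom mj(2^{m - j} + 1)P_2 (j,n), \] \[ C (m) =- 1 - \sum_{j = 0}^{m - 1} \binom mj(2^{m - j} + 1)C (j),\qquad K (m) = -(2^{m + 1} + 1) - \sum_{j = 0}^{m - 1} \binom mj(2^{m - j} + 1)K (j). \]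
   Context: $F_j$ and $L_j$ are the Fibonacci and Lucas numbers: $F_0=0$, $F_1=1$, $L_0=2$, $L_1=1$, $X_j=X_{j-1}+X_{j-2}$. Empty sums are $0$ (so e.g. $P_1(0,n)=1$, $P_2(0,n)=1$, $C(0)=-1$, $K(0)=-3$), and $0^0=1$. -}

module Defs where

open import Data.Nat using (ℕ; zero; suc)
import Data.Nat as ℕ
open import Data.Nat.Combinatorics using (_C_)
open import Data.Integer using (ℤ; +_; _+_; _-_; _*_; -_; 0ℤ)
open import Data.List using (List; []; _∷_; _++_; [_])

fib : ℕ → ℤ
fib 0 = + 0
fib 1 = + 1
fib (suc (suc n)) = fib (suc n) + fib n

lucas : ℕ → ℤ
lucas 0 = + 2
lucas 1 = + 1
lucas (suc (suc n)) = lucas (suc n) + lucas n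

sum1 : ℕ → (ℕ → ℤ) → ℤ
sum1 zero f = 0ℤ
sum1 (suc n) f = sum1 n f + f (suc n)

-- Course-of-values recursion for sequences X satisfying
--   X(m) = b(m) - Σ_{j=0}^{m-1} binom(m,j) (2^{m-j} + 1) X(j).
-- Given the list [X 0, …, X (m-1)] (starting at index j), compute the sum.
corrSum : ℕ → ℕ → List ℤ → ℤ
corrSum m j [] = 0ℤ
corrSum m j (x ∷ xs) =
  (+ (m C j)) * (+ (2 ℕ.^ (m ℕ.∸ j) ℕ.+ 1)) * x + corrSum m (suc j) xs

table : (ℕ → ℤ) → ℕ → List ℤ
table b zero = []
table b (suc m) = table b m ++ [ b m - corrSum m 0 (table b m) ]

recSeq : (ℕ → ℤ) → ℕ → ℤ
recSeq b m = b m - corrSum m 0 (table b m)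

P₁ : ℕ → ℕ → ℤ
P₁ m n = recSeq (λ i → + ((n ℕ.+ 2) ℕ.^ i)) m

P₂ : ℕ → ℕ → ℤ
P₂ m n = recSeq (λ i → + ((n ℕ.+ 1) ℕ.^ i)) m

Cc : ℕ → ℤ
Cc m = recSeq (λ _ → - (+ 1)) m

Kk : ℕ → ℤ
Kk m = recSeq (λ i → - (+ (2 ℕ.^ (suc i) ℕ.+ 1))) m

{-# OPTIONS --safe #-}
-- All four sequences solve the triangular linear system
--   X(m) + Σ_{j<m} C(m,j) (2^(m-j) + 1) X(j) = b(m),
-- so each is determined by its right-hand side b, and depends linearly on it. By the
-- binomial theorem x^m solves the system for b(m) = (x+2)^m + (x+1)^m - x^m. Comparing
-- right-hand sides gives P₂(m,n+1) = P₁(m,n), P₁(m,n+1) = (n+1)^m - P₁(m,n) + P₂(m,n),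
-- C(m) = -P₂(m,0) and K(m) = -2P₁(m,0) - P₂(m,0). The first two make the right-hand
-- side of the theorem satisfy the same recursion in n as the sum, for any G with
-- G(k+2) = G(k+1) + G(k); the last two make both sides agree at n = 0.
module Submission where

open import Defs
open import Data.Nat using (ℕ; suc; _^_)
open import Data.Integer using (ℤ; +_; _+_; _*_)
open import Data.Product using (_×_)
open import Relation.Binary.PropositionalEquality using (_≡_)

open import Data.Nat using (zero; _∸_; _<_)
import Data.Nat as ℕ
import Data.Nat.Properties as ℕ
open import Data.Nat.Combinatorics using (_C_; nCn≡1)
open import Data.Nat.Induction using (<-rec)
open import Data.Fin using (toℕ; inject₁; fromℕ)
open import Data.Fin.Properties using (toℕ-inject₁; toℕ-fromℕ; toℕ<n)
open import Data.Integer using (_-_; -_; 0ℤ; 1ℤ)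
open import Data.Integer.Properties
  using (pos-+; pos-*; +-comm; +-assoc; *-distribˡ-+; +-*-semiring; +-*-commutativeSemiring)
open import Data.Integer.Tactic.RingSolver using (solve-∀)
open import Data.List using ([]; _∷_; _++_; [_]; length)
open import Data.List.Properties using (length-++)
open import Data.Product using (_,_)
open import Function using (_∘_)
open import Relation.Binary.PropositionalEquality
  using (refl; sym; trans; cong; cong₂; _≗_; module ≡-Reasoning)
open import Algebra.Properties.Semiring.Sum +-*-semiring
  using (sum-syntax; sum⁺-syntax; sum-init-last; sum-cong-≗; ∑-distrib-+; *-distribˡ-sum)
open import Algebra.Properties.Semiring.Mult +-*-semiring using () renaming (_×_ to _×ℤ_)
open import Algebra.Properties.Semiring.Exp +-*-semiring using () renaming (_^_ to _^ℤ_)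
import Algebra.Properties.CommutativeSemiring.Binomial +-*-commutativeSemiring as Binomial

open ≡-Reasoning

∑-snoc : ∀ (f : ℕ → ℤ) k → ∑[ j < suc k ] f (toℕ j) ≡ ∑[ j < k ] f (toℕ j) + f k
∑-snoc f k = begin
  ∑[ j < suc k ] f (toℕ j)                            ≡⟨ sum-init-last {k} (f ∘ toℕ) ⟩
  ∑[ j < k ] f (toℕ (inject₁ j)) + f (toℕ (fromℕ k))
    ≡⟨ cong₂ _+_ (sum-cong-≗ {k} (cong f ∘ toℕ-inject₁)) (cong f (toℕ-fromℕ k)) ⟩
  ∑[ j < k ] f (toℕ j) + f k                          ∎

weight : ℕ → ℕ → ℤ
weight m j = + (m C j) * + (2 ^ (m ∸ j) ℕ.+ 1)

weightedSum : ℕ → (ℕ → ℤ) → ℕ → ℤ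
weightedSum m X k = ∑[ j < k ] (weight m (toℕ j) * X (toℕ j))

weightedSum-cong : ∀ m {X Y} k → (∀ {i} → i < k → X i ≡ Y i) → weightedSum m X k ≡ weightedSum m Y k
weightedSum-cong m k X≡Y = sum-cong-≗ {k} (λ j → cong (weight m (toℕ j) *_) (X≡Y (toℕ<n j)))

weightedSum-+ : ∀ m X Y k → weightedSum m (λ i → X i + Y i) k ≡ weightedSum m X k + weightedSum m Y k
weightedSum-+ m X Y k = trans (sum-cong-≗ {k} (λ j → *-distribˡ-+ (weight m (toℕ j)) (X (toℕ j)) (Y (toℕ j))))
                              (∑-distrib-+ {k} _ _)

weightedSum-* : ∀ m p X k → weightedSum m (λ i → p * X i) k ≡ p * weightedSum m X k
weightedSum-* m p X k = trans (sum-cong-≗ {k} (λ j → swap (weight m (toℕ j)) p (X (toℕ j))))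
                              (sym (*-distribˡ-sum {k} p _))
  where swap : ∀ w p x → w * (p * x) ≡ p * (w * x)
        swap = solve-∀

corrSum-snoc : ∀ m j xs x → corrSum m j (xs ++ [ x ]) ≡ corrSum m j xs + weight m (j ℕ.+ length xs) * x
corrSum-snoc m j []       x = begin
  weight m j * x + 0ℤ          ≡⟨ +-comm (weight m j * x) 0ℤ ⟩
  0ℤ + weight m j * x          ≡⟨ cong (λ i → 0ℤ + weight m i * x) (sym (ℕ.+-identityʳ j)) ⟩
  0ℤ + weight m (j ℕ.+ 0) * x  ∎
corrSum-snoc m j (y ∷ xs) x = begin
  weight m j * y + corrSum m (suc j) (xs ++ [ x ])
    ≡⟨ cong (_+_ (weight m j * y)) (corrSum-snoc m (suc j) xs x) ⟩
  weight m j * y + (corrSum m (suc j) xs + weight m (suc j ℕ.+ length xs) * x)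
    ≡⟨ sym (+-assoc (weight m j * y) _ _) ⟩
  weight m j * y + corrSum m (suc j) xs + weight m (suc j ℕ.+ length xs) * x
    ≡⟨ cong (λ i → weight m j * y + corrSum m (suc j) xs + weight m i * x) (sym (ℕ.+-suc j (length xs))) ⟩
  weight m j * y + corrSum m (suc j) xs + weight m (j ℕ.+ suc (length xs)) * x ∎

length-table : ∀ b k → length (table b k) ≡ k
length-table b zero    = refl
length-table b (suc k) = trans (length-++ (table b k)) (trans (ℕ.+-comm _ 1) (cong suc (length-table b k)))

corrSum-table : ∀ b m k → corrSum m 0 (table b k) ≡ weightedSum m (recSeq b) k
corrSum-table b m zero    = refl
corrSum-table b m (suc k) = begin
  corrSum m 0 (table b k ++ [ recSeq b k ])                            ≡⟨ corrSum-snoc m 0 (table b k) (recSeq b k) ⟩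
  corrSum m 0 (table b k) + weight m (length (table b k)) * recSeq b k
    ≡⟨ cong₂ (λ s i → s + weight m i * recSeq b k) (corrSum-table b m k) (length-table b k) ⟩
  weightedSum m (recSeq b) k + weight m k * recSeq b k                 ≡⟨ sym (∑-snoc (λ i → weight m i * recSeq b i) k) ⟩
  weightedSum m (recSeq b) (suc k)                                     ∎

-- A record rather than a function type, so that b and X can be inferred from a proof.
record IsRecSeq (b X : ℕ → ℤ) : Set where
  field recurrence : ∀ m → X m ≡ b m - weightedSum m X m
open IsRecSeq

recSeq-isRecSeq : ∀ b → IsRecSeq b (recSeq b)
recurrence (recSeq-isRecSeq b) m = cong (_-_ (b m)) (corrSum-table b m m)

isRecSeq-unique : ∀ {b c X Y} → IsRecSeq b X → IsRecSeq c Y → b ≗ c → X ≗ Y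
isRecSeq-unique {b} {c} {X} {Y} recX recY b≗c = <-rec (λ m → X m ≡ Y m) step
  where
  step : ∀ m → (∀ {i} → i < m → X i ≡ Y i) → X m ≡ Y m
  step m IH = begin
    X m                      ≡⟨ recurrence recX m ⟩
    b m - weightedSum m X m  ≡⟨ cong₂ _-_ (b≗c m) (weightedSum-cong m m IH) ⟩
    c m - weightedSum m Y m  ≡⟨ recurrence recY m ⟨
    Y m                      ∎

isRecSeq-+ : ∀ {b c X Y} → IsRecSeq b X → IsRecSeq c Y → IsRecSeq (λ i → b i + c i) (λ i → X i + Y i)
recurrence (isRecSeq-+ {b} {c} {X} {Y} recX recY) m = begin
  X m + Y m                                                    ≡⟨ cong₂ _+_ (recurrence recX m) (recurrence recY m) ⟩
  (b m - weightedSum m X m) + (c m - weightedSum m Y m)        ≡⟨ regroup (b m) (c m) _ _ ⟩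
  (b m + c m) - (weightedSum m X m + weightedSum m Y m)        ≡⟨ cong (_-_ (b m + c m)) (weightedSum-+ m X Y m) ⟨
  (b m + c m) - weightedSum m (λ i → X i + Y i) m              ∎
  where regroup : ∀ b c s t → (b - s) + (c - t) ≡ (b + c) - (s + t)
        regroup = solve-∀

isRecSeq-* : ∀ p {b X} → IsRecSeq b X → IsRecSeq (λ i → p * b i) (λ i → p * X i)
recurrence (isRecSeq-* p {b} {X} recX) m = begin
  p * X m                                  ≡⟨ cong (p *_) (recurrence recX m) ⟩
  p * (b m - weightedSum m X m)            ≡⟨ distrib p (b m) _ ⟩
  p * b m - p * weightedSum m X m          ≡⟨ cong (_-_ (p * b m)) (weightedSum-* m p X m) ⟨
  p * b m - weightedSum m (λ i → p * X i) m ∎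
  where distrib : ∀ p b s → p * (b - s) ≡ p * b - p * s
        distrib = solve-∀

pos-^ : ∀ x k → + (x ^ k) ≡ (+ x) ^ℤ k
pos-^ x zero    = refl
pos-^ x (suc k) = trans (pos-* x (x ^ k)) (cong (+ x *_) (pos-^ x k))

×ℤ-as-* : ∀ n z → n ×ℤ z ≡ + n * z
×ℤ-as-* zero    z = refl
×ℤ-as-* (suc n) z = begin
  z + n ×ℤ z      ≡⟨ cong (_+_ z) (×ℤ-as-* n z) ⟩
  z + + n * z     ≡⟨ distrib (+ n) z ⟩
  (1ℤ + + n) * z  ≡⟨ cong (_* z) (pos-+ 1 n) ⟨
  + suc n * z     ∎
  where distrib : ∀ n z → z + n * z ≡ (1ℤ + n) * z
        distrib = solve-∀

pos-binomial : ∀ x a m →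
  + ((x ℕ.+ a) ^ m) ≡ ∑[ j ≤ m ] (+ (m C toℕ j) * (+ (x ^ toℕ j) * + (a ^ (m ∸ toℕ j))))
pos-binomial x a m = begin
  + ((x ℕ.+ a) ^ m)                          ≡⟨ pos-^ (x ℕ.+ a) m ⟩
  (+ (x ℕ.+ a)) ^ℤ m                         ≡⟨ cong (_^ℤ m) (pos-+ x a) ⟩
  (+ x + + a) ^ℤ m                           ≡⟨ Binomial.theorem m (+ x) (+ a) ⟩
  Binomial.binomialExpansion (+ x) (+ a) m   ≡⟨ sum-cong-≗ {suc m} term ⟩
  ∑[ j ≤ m ] (+ (m C toℕ j) * (+ (x ^ toℕ j) * + (a ^ (m ∸ toℕ j)))) ∎
  where
  term : ∀ j → Binomial.binomialTerm (+ x) (+ a) m j ≡ + (m C toℕ j) * (+ (x ^ toℕ j) * + (a ^ (m ∸ toℕ j)))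
  term j = trans (×ℤ-as-* (m C toℕ j) _)
                 (sym (cong₂ (λ u v → + (m C toℕ j) * (u * v)) (pos-^ x (toℕ j)) (pos-^ a (m ∸ toℕ j))))

-- Since 2^(m-j) + 1 = 2^(m-j) + 1^(m-j), the weighted sum of powers splits into two binomial expansions.
weightedSum-pow : ∀ x m →
  weightedSum m (λ i → + (x ^ i)) (suc m) ≡ + ((x ℕ.+ 2) ^ m) + + ((x ℕ.+ 1) ^ m)
weightedSum-pow x m = begin
  weightedSum m (λ i → + (x ^ i)) (suc m)     ≡⟨ sum-cong-≗ {suc m} (split ∘ toℕ) ⟩
  ∑[ j ≤ m ] (term 2 (toℕ j) + term 1 (toℕ j)) ≡⟨ ∑-distrib-+ {suc m} (term 2 ∘ toℕ) (term 1 ∘ toℕ) ⟩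
  ∑[ j ≤ m ] term 2 (toℕ j) + ∑[ j ≤ m ] term 1 (toℕ j)
    ≡⟨ cong₂ _+_ (pos-binomial x 2 m) (pos-binomial x 1 m) ⟨
  + ((x ℕ.+ 2) ^ m) + + ((x ℕ.+ 1) ^ m)       ∎
  where
  term : ℕ → ℕ → ℤ
  term a j = + (m C j) * (+ (x ^ j) * + (a ^ (m ∸ j)))
  split : ∀ j → weight m j * + (x ^ j) ≡ term 2 j + term 1 j
  split j = begin
    + (m C j) * + (2 ^ (m ∸ j) ℕ.+ 1) * + (x ^ j)
      ≡⟨ cong (λ s → + (m C j) * (+ (2 ^ (m ∸ j)) + + s) * + (x ^ j)) (ℕ.^-zeroˡ (m ∸ j)) ⟨
    + (m C j) * (+ (2 ^ (m ∸ j)) + + (1 ^ (m ∸ j))) * + (x ^ j)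
      ≡⟨ expand (+ (m C j)) (+ (2 ^ (m ∸ j))) (+ (1 ^ (m ∸ j))) (+ (x ^ j)) ⟩
    term 2 j + term 1 j ∎
    where expand : ∀ c t u y → c * (t + u) * y ≡ c * (y * t) + c * (y * u)
          expand = solve-∀

weight-diagonal : ∀ m → weight m m ≡ + 2
weight-diagonal m rewrite nCn≡1 m | ℕ.n∸n≡0 m = refl

pow-isRecSeq : ∀ x → IsRecSeq (λ i → + ((x ℕ.+ 2) ^ i) + + ((x ℕ.+ 1) ^ i) - + (x ^ i)) (λ i → + (x ^ i))
recurrence (pow-isRecSeq x) m = begin
  X                                        ≡⟨ rearrange S X ⟩
  (S + + 2 * X) - X - S                    ≡⟨ cong (λ w → (S + w * X) - X - S) (weight-diagonal m) ⟨
  (S + weight m m * X) - X - S             ≡⟨ cong (λ t → t - X - S) (∑-snoc (λ i → weight m i * + (x ^ i)) m) ⟨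
  weightedSum m (λ i → + (x ^ i)) (suc m) - X - S
    ≡⟨ cong (λ t → t - X - S) (weightedSum-pow x m) ⟩
  + ((x ℕ.+ 2) ^ m) + + ((x ℕ.+ 1) ^ m) - X - S ∎
  where
  X = + (x ^ m)
  S = weightedSum m (λ i → + (x ^ i)) m
  rearrange : ∀ s x → x ≡ (s + + 2 * x) - x - s
  rearrange = solve-∀

P₁-isRecSeq : ∀ n → IsRecSeq (λ i → + ((n ℕ.+ 2) ^ i)) (λ i → P₁ i n)
P₁-isRecSeq n = recSeq-isRecSeq _

P₂-isRecSeq : ∀ n → IsRecSeq (λ i → + ((n ℕ.+ 1) ^ i)) (λ i → P₂ i n)
P₂-isRecSeq n = recSeq-isRecSeq _

P₂-suc : ∀ m n → P₂ m (suc n) ≡ P₁ m n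
P₂-suc m n = isRecSeq-unique (P₂-isRecSeq (suc n)) (P₁-isRecSeq n)
               (λ i → cong (λ k → + (k ^ i)) (sym (ℕ.+-suc n 1))) m

P₁-suc : ∀ m n → P₁ m (suc n) ≡ + (suc n ^ m) - P₁ m n + P₂ m n
P₁-suc m n = trans (rearrange (P₁ m (suc n)) (P₁ m n) (P₂ m n)) (cong (λ y → y - P₁ m n + P₂ m n) (sym powers))
  where
  combination : IsRecSeq _ (λ i → P₁ i (suc n) + (P₁ i n + - 1ℤ * P₂ i n))
  combination = isRecSeq-+ (P₁-isRecSeq (suc n)) (isRecSeq-+ (P₁-isRecSeq n) (isRecSeq-* (- 1ℤ) (P₂-isRecSeq n)))
  powers : + (suc n ^ m) ≡ P₁ m (suc n) + (P₁ m n + - 1ℤ * P₂ m n)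
  powers = isRecSeq-unique (pow-isRecSeq (suc n)) combination
    (λ i → trans (cong₂ (λ k l → + ((suc n ℕ.+ 2) ^ i) + + (k ^ i) - + (l ^ i)) (sym (ℕ.+-suc n 1)) (ℕ.+-comm 1 n))
                 (neg-as-* (+ ((suc n ℕ.+ 2) ^ i)) (+ ((n ℕ.+ 2) ^ i)) (+ ((n ℕ.+ 1) ^ i)))) m
    where neg-as-* : ∀ a b c → a + b - c ≡ a + (b + - 1ℤ * c)
          neg-as-* = solve-∀
  rearrange : ∀ p q r → p ≡ (p + (q + - 1ℤ * r)) - q + r
  rearrange = solve-∀

Cc≡-P₂ : ∀ m → Cc m ≡ - 1ℤ * P₂ m 0
Cc≡-P₂ = isRecSeq-unique (recSeq-isRecSeq (λ _ → - + 1)) (isRecSeq-* (- 1ℤ) (P₂-isRecSeq 0))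
           (λ i → cong (λ k → - 1ℤ * + k) (sym (ℕ.^-zeroˡ i)))

Kk≡-2P₁-P₂ : ∀ m → Kk m ≡ - + 2 * P₁ m 0 + - 1ℤ * P₂ m 0
Kk≡-2P₁-P₂ = isRecSeq-unique (recSeq-isRecSeq (λ i → - + (2 ^ suc i ℕ.+ 1)))
               (isRecSeq-+ (isRecSeq-* (- + 2) (P₁-isRecSeq 0)) (isRecSeq-* (- 1ℤ) (P₂-isRecSeq 0)))
               (λ i → trans (cong -_ (pos-+ (2 ^ suc i) 1))
                            (trans (cong (λ k → - (k + 1ℤ)) (pos-* 2 (2 ^ i)))
                                   (trans (expand (+ (2 ^ i))) (cong (λ k → - + 2 * + (2 ^ i) + - 1ℤ * + k) (sym (ℕ.^-zeroˡ i))))))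
  where expand : ∀ t → - (+ 2 * t + 1ℤ) ≡ - + 2 * t + - 1ℤ * 1ℤ
        expand = solve-∀

sum-pow-mul-fibonacciLike : ∀ m (G : ℕ → ℤ) c →
  (∀ k → G (suc (suc k)) ≡ G (suc k) + G k) →
  P₁ m 0 * G 0 + P₂ m 0 * G 1 + c ≡ 0ℤ →
  ∀ n → sum1 n (λ k → + (k ^ m) * G k) ≡ P₁ m n * G n + P₂ m n * G (suc n) + c
sum-pow-mul-fibonacciLike m G c G-rec base zero    = sym base
sum-pow-mul-fibonacciLike m G c G-rec base (suc n) = begin
  sum1 n (λ k → + (k ^ m) * G k) + y * G (suc n)
    ≡⟨ cong (_+ y * G (suc n)) (sum-pow-mul-fibonacciLike m G c G-rec base n) ⟩
  P₁ m n * G n + P₂ m n * G (suc n) + c + y * G (suc n)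
    ≡⟨ regroup (P₁ m n) (P₂ m n) y (G n) (G (suc n)) c ⟩
  (y - P₁ m n + P₂ m n) * G (suc n) + P₁ m n * (G (suc n) + G n) + c
    ≡⟨ cong₂ (λ p q → p * G (suc n) + q + c) (P₁-suc m n) (cong₂ _*_ (P₂-suc m n) (G-rec n)) ⟨
  P₁ m (suc n) * G (suc n) + P₂ m (suc n) * G (suc (suc n)) + c ∎
  where
  y = + (suc n ^ m)
  regroup : ∀ p q y g₀ g₁ c → p * g₀ + q * g₁ + c + y * g₁ ≡ (y - p + q) * g₁ + p * (g₁ + g₀) + c
  regroup = solve-∀

theorem1 : (m n : ℕ) →
    (sum1 n (λ k → + (k ^ m) * fib k) ≡ P₁ m n * fib n + P₂ m n * fib (suc n) + Cc m)
    × (sum1 n (λ k → + (k ^ m) * lucas k) ≡ P₁ m n * lucas n + P₂ m n * lucas (suc n) + Kk m)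
theorem1 m n =
    sum-pow-mul-fibonacciLike m fib (Cc m) (λ _ → refl) fib-base n
  , sum-pow-mul-fibonacciLike m lucas (Kk m) (λ _ → refl) lucas-base n
  where
  fib-base : P₁ m 0 * + 0 + P₂ m 0 * + 1 + Cc m ≡ 0ℤ
  fib-base = trans (cong (_+_ (P₁ m 0 * + 0 + P₂ m 0 * + 1)) (Cc≡-P₂ m)) (cancel (P₁ m 0) (P₂ m 0))
    where cancel : ∀ p q → p * + 0 + q * + 1 + - 1ℤ * q ≡ 0ℤ
          cancel = solve-∀
  lucas-base : P₁ m 0 * + 2 + P₂ m 0 * + 1 + Kk m ≡ 0ℤ
  lucas-base = trans (cong (_+_ (P₁ m 0 * + 2 + P₂ m 0 * + 1)) (Kk≡-2P₁-P₂ m)) (cancel (P₁ m 0) (P₂ m 0))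
    where cancel : ∀ p q → p * + 2 + q * + 1 + (- + 2 * p + - 1ℤ * q) ≡ 0ℤ
          cancel = solve-∀
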